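{- Let $t\geq 2$ and $0\leq k\leq t$ be integers, let $m_{1}, \dots, m_{k}$ be even integers larger than one and $m_{k+ 1}, \dots, m_{t}$ be odd integers larger than one, and let $n\geq r(K_{1, m_{1}}, \dots, K_{1, m_{t}})$. Let $f(n)$ be the minimum integer such that every graph $G$ on $n$ vertices with minimum degree $\delta(G)\geq f(n)$ satisfies $G\rightarrow (K_{1, m_{1}}, \dots, K_{1, m_{t}})$. Then $$f(n)= \begin{cases} \sum_{i= 1}^{t} m_{i}- t+ 1, & \text{if $k= 0$ or $n$ is even},\\ \sum_{i= 1}^{t} m_{i}- t, & \text{otherwise}. \end{cases}$$
   Context: $K_{1,n}$ denotes the star with $n$ edges and $K_N$ the complete graph on $N$ vertices. For graphs $G, H_1,\dots,H_t$, write $G\rightarrow (H_{1}, \dots, H_{t})$ if every coloring of $E(G)$ with colors $1,\dots,t$ yields, for some $i\in[t]$, a copy of $H_i$ (as a subgraph) all of whose edges have color $i$. The Ramsey number $r(H_{1}, \dots, H_{t})$ is the minimum integer $N$ such that $K_{N}\rightarrow (H_{1}, \dots, H_{t})$. $\delta(G)$ is the minimum degree of $G$. -}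

module Defs where

open import Data.Nat using (ℕ; _≤_; _+_; _∸_)
open import Data.Fin using (Fin; _≟_)
open import Data.Bool using (Bool; true; false; not)
open import Data.List using (List; length; filterᵇ; allFin; map)
open import Data.Nat.ListAction using (sum)
open import Data.Product using (Σ; ∃; _×_)
open import Relation.Binary.PropositionalEquality using (_≡_; refl; sym)
open import Relation.Nullary using (yes; no)
open import Data.Empty using (⊥-elim)
open import Relation.Nullary using (¬_; does)
open import Function.Definitions using (Injective)

record Graph (n : ℕ) : Set where
  field
    adj    : Fin n → Fin n → Bool
    adj-sym    : ∀ u v → adj u v ≡ adj v u
    adj-irrefl : ∀ v → adj v v ≡ false
open Graph public

complete : (N : ℕ) → Graph N
complete N = record
  { adj = λ u v → not (does (u ≟ v))
  ; adj-sym = symK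
  ; adj-irrefl = irrK }
  where
  symK : ∀ (u v : Fin N) → not (does (u ≟ v)) ≡ not (does (v ≟ u))
  symK u v with u ≟ v | v ≟ u
  ... | yes _ | yes _ = refl
  ... | no _  | no _  = refl
  ... | yes p | no q  = ⊥-elim (q (sym p))
  ... | no p  | yes q = ⊥-elim (p (sym q))
  irrK : ∀ (v : Fin N) → not (does (v ≟ v)) ≡ false
  irrK v with v ≟ v
  ... | yes _ = refl
  ... | no p  = ⊥-elim (p refl)

degree : ∀ {n} → Graph n → Fin n → ℕ
degree G v = length (filterᵇ (adj G v) (allFin _))

MinDegreeAtLeast : ∀ {n} → Graph n → ℕ → Set
MinDegreeAtLeast G d = ∀ v → d ≤ degree G v

-- An edge colouring with colours Fin t: a symmetric colour function on
-- pairs (only its values on edges of G matter).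
record Colouring (n t : ℕ) : Set where
  field
    col     : Fin n → Fin n → Fin t
    col-sym : ∀ u v → col u v ≡ col v u
open Colouring public

MonoStar : ∀ {n t} → Graph n → Colouring n t → Fin t → ℕ → Set
MonoStar {n} G c i m =
  Σ (Fin n) λ v → Σ (Fin m → Fin n) λ e →
    Injective _≡_ _≡_ e × (∀ j → (adj G v (e j) ≡ true) × (col c v (e j) ≡ i))

Arrows : ∀ {n t} → Graph n → (Fin t → ℕ) → Set
Arrows {n} {t} G m = ∀ (c : Colouring n t) → ∃ λ i → MonoStar G c i (m i)

IsLeast : (ℕ → Set) → ℕ → Set
IsLeast P N = P N × (∀ M → P M → N ≤ M)

IsStarRamseyNumber : ∀ {t} → (Fin t → ℕ) → ℕ → Set
IsStarRamseyNumber m r = IsLeast (λ N → Arrows (complete N) m) r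

IsMinDegreeThreshold : ∀ {t} → ℕ → (Fin t → ℕ) → ℕ → Set
IsMinDegreeThreshold n m d =
  IsLeast (λ d' → ∀ (G : Graph n) → MinDegreeAtLeast G d' → Arrows G m) d

sumFin : ∀ {t} → (Fin t → ℕ) → ℕ
sumFin {t} m = sum (map m (allFin t))

{-# OPTIONS --safe #-}
module Submission where

-- Write w i = m i ∸ 1 and s = Σ w i.  At a vertex of degree > s some colour i occurs at least
-- m i times (pigeonhole).  For odd n and some even m i, degree ≥ s already forces a star:
-- otherwise colour class i would be w i-regular with w i and n odd.
-- For the lower bounds, label the edges of K_n symmetrically so that every vertex sees each
-- label at most once, keep the edges with label < s, and colour label c by the block of
-- [0, s) = [0, w 0) ∪ [w 0, w 0 + w 1) ∪ … containing it.  The sum labelling x + y mod n gives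
-- minimum degree s ∸ 1, and the round-robin 1-factorisation degree s when n is even.  When n
-- is odd and all w i are even, the circulant graph with distances 1, …, s / 2 is s-regular;
-- there colour i takes w i / 2 distances, each met twice at every vertex.  The sum labelling
-- of K_s shows s < r ≤ n.

open import Defs
open import Data.Nat using (ℕ; _≤_; _<_; _+_; _∸_)
open import Data.Nat.Divisibility using (_∣_)
open import Data.Fin using (Fin; toℕ)
open import Data.Product using (_×_)
open import Data.Sum using (_⊎_)
open import Relation.Binary.PropositionalEquality using (_≡_)
open import Relation.Nullary using (¬_)

open import Data.Nat using (zero; suc; _*_; z≤n; s≤s; s≤s⁻¹; NonZero; _≤?_; _<?_; _≟_)
open import Data.Nat.Properties
open import Data.Nat.DivMod using (_%_; _/_; m<n*o⇒m/o<n; m≡m%n+[m/n]*n; %-distribˡ-+; %-distribˡ-*; m%n%n≡m%n;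
  [m+n]%n≡m%n; [m+kn]%n≡m%n; m<n⇒m%n≡m; m%n<n; n%n≡0)
open import Data.Nat.Divisibility using (divides; ∣m∣n⇒∣m+n; ∣m+n∣m⇒∣n; ∣1⇒≡1)
open import Data.Nat.Primality using (Prime; prime?; euclidsLemma)
open import Data.Nat.Solver using (module +-*-Solver)
import Data.Nat.ListAction as List
open import Data.Fin using (zero; suc; fromℕ<) renaming (_≟_ to _≟ᶠ_)
open import Data.Fin.Properties using (toℕ-injective; toℕ-fromℕ<; toℕ<n; injective⇒≤; any?)
  renaming (suc-injective to fsuc-injective)
open import Data.Bool using (Bool; true; false; not; _∧_)
open import Data.Bool.Properties using (∧-zeroʳ; ∧-identityʳ; ∧-comm)
open import Data.List using (tabulate; filterᵇ; length)
open import Data.List.Properties using (map-tabulate)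
open import Data.Product using (Σ-syntax; ∃; _,_; proj₁; proj₂)
open import Data.Sum using (inj₁; inj₂; [_,_]′)
open import Data.Empty using (⊥-elim)
open import Data.Unit using (⊤; tt)
open import Function using (_∘_; id)
open import Function.Bundles using (mk⇔)
open import Function.Definitions using (Injective)
open import Relation.Binary.PropositionalEquality using (_≢_; refl; sym; trans; cong; cong₂; subst; subst₂; module ≡-Reasoning)
open import Relation.Nullary using (Dec; yes; no; does; contradiction)
open import Relation.Nullary.Decidable using (dec-true; dec-false; does-⇔; from-yes)
open import Algebra.Properties.CommutativeMonoid.Sum +-0-commutativeMonoid using (sum; sum-cong-≗; ∑-distrib-+; ∑-comm)

∧-≡-true : ∀ {a b} → a ∧ b ≡ true → a ≡ true × b ≡ true
∧-≡-true {true} b≡true = refl , b≡true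

∧-intro : ∀ {a b} → a ≡ true → b ≡ true → a ∧ b ≡ true
∧-intro refl refl = refl

does-≡-true : ∀ {P : Set} (P? : Dec P) → does P? ≡ true → P
does-≡-true (yes p) _ = p

not-does-≡-true : ∀ {P : Set} (P? : Dec P) → not (does P?) ≡ true → ¬ P
not-does-≡-true (no ¬p) _ = ¬p

sum-const : ∀ n c → sum {n} (λ _ → c) ≡ n * c
sum-const zero    c = refl
sum-const (suc n) c = cong (c +_) (sum-const n c)

sum-zero : ∀ n → sum {n} (λ _ → 0) ≡ 0
sum-zero n = trans (sum-const n 0) (*-zeroʳ n)

sum-suc : ∀ {n} (f : Fin n → ℕ) → sum (suc ∘ f) ≡ n + sum f
sum-suc {n} f = trans (∑-distrib-+ (λ _ → 1) f) (cong (_+ sum f) (trans (sum-const n 1) (*-identityʳ n)))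

sum-* : ∀ {t} c (f : Fin t → ℕ) → sum (λ i → c * f i) ≡ c * sum f
sum-* {zero}  c f = sym (*-zeroʳ c)
sum-* {suc t} c f = trans (cong (c * f zero +_) (sum-* c (f ∘ suc))) (sym (*-distribˡ-+ c (f zero) _))

sum-mono-≤ : ∀ {n} {f g : Fin n → ℕ} → (∀ i → f i ≤ g i) → sum f ≤ sum g
sum-mono-≤ {zero}  f≤g = z≤n
sum-mono-≤ {suc n} f≤g = +-mono-≤ (f≤g zero) (sum-mono-≤ (f≤g ∘ suc))

sum-mono-< : ∀ {n} {f g : Fin n → ℕ} → (∀ i → f i ≤ g i) → ∀ i → f i < g i → sum f < sum g
sum-mono-< f≤g zero    f<g = +-mono-<-≤ f<g (sum-mono-≤ (f≤g ∘ suc))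
sum-mono-< f≤g (suc i) f<g = +-mono-≤-< (f≤g zero) (sum-mono-< (f≤g ∘ suc) i f<g)

sum-≤-squeeze : ∀ {n} {f g : Fin n → ℕ} → (∀ i → f i ≤ g i) → sum g ≤ sum f → ∀ i → f i ≡ g i
sum-≤-squeeze f≤g Σg≤Σf i = ≤-antisym (f≤g i) (≮⇒≥ λ f<g → <⇒≱ (sum-mono-< f≤g i f<g) Σg≤Σf)

sumFin≡sum : ∀ {t} (m : Fin t → ℕ) → sumFin m ≡ sum m
sumFin≡sum {zero}  m = refl
sumFin≡sum {suc t} m = cong (m zero +_)
  (trans (cong List.sum (trans (map-tabulate suc m) (sym (map-tabulate id (m ∘ suc))))) (sumFin≡sum (m ∘ suc)))

sumFin∸≡sum : ∀ {t} {m w : Fin t → ℕ} → (∀ i → m i ≡ suc (w i)) → sumFin m ∸ t ≡ sum w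
sumFin∸≡sum {t} {m} {w} m≡suc-w = begin
  sumFin m ∸ t       ≡⟨ cong (_∸ t) (trans (sumFin≡sum m) (sum-cong-≗ m≡suc-w)) ⟩
  sum (suc ∘ w) ∸ t  ≡⟨ cong (_∸ t) (sum-suc w) ⟩
  t + sum w ∸ t      ≡⟨ m+n∸m≡n t (sum w) ⟩
  sum w              ∎
  where open ≡-Reasoning

indicator : Bool → ℕ
indicator true  = 1
indicator false = 0

count : ∀ {n} → (Fin n → Bool) → ℕ
count p = sum (indicator ∘ p)

count-cong : ∀ {n} {p q : Fin n → Bool} → (∀ y → p y ≡ q y) → count p ≡ count q
count-cong p≗q = sum-cong-≗ (cong indicator ∘ p≗q)

length-filter-tabulate : ∀ {n m} (f : Fin n → Fin m) (p : Fin m → Bool) →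
  length (filterᵇ p (tabulate f)) ≡ count (p ∘ f)
length-filter-tabulate {zero}  f p = refl
length-filter-tabulate {suc n} f p with p (f zero)
... | true  = cong suc (length-filter-tabulate (f ∘ suc) p)
... | false = length-filter-tabulate (f ∘ suc) p

degree≡count : ∀ {n} (G : Graph n) v → degree G v ≡ count (adj G v)
degree≡count G v = length-filter-tabulate id (adj G v)

injective-below⇒≤ : ∀ {d B} (f : Fin d → ℕ) → (∀ j → f j < B) → (∀ {j j'} → f j ≡ f j' → j ≡ j') → d ≤ B
injective-below⇒≤ f f<B f-inj = injective⇒≤ {f = λ j → fromℕ< (f<B j)} λ {j} {j'} eq →
  f-inj (trans (sym (toℕ-fromℕ< (f<B j))) (trans (cong toℕ eq) (toℕ-fromℕ< (f<B j'))))

index : ∀ {n} → (Fin n → Bool) → Fin n → ℕ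
index p zero    = 0
index p (suc y) = indicator (p zero) + index (p ∘ suc) y

index<count : ∀ {n} (p : Fin n → Bool) y → p y ≡ true → index p y < count p
index<count p zero    py rewrite py = s≤s z≤n
index<count p (suc y) py = +-monoʳ-< (indicator (p zero)) (index<count (p ∘ suc) y py)

index-injective : ∀ {n} (p : Fin n → Bool) {y z} → p y ≡ true → p z ≡ true → index p y ≡ index p z → y ≡ z
index-injective p {zero}  {zero}  _  _  _ = refl
index-injective p {zero}  {suc z} py _  eq rewrite py = ⊥-elim (0≢1+n eq)
index-injective p {suc y} {zero}  _  pz eq rewrite pz = ⊥-elim (0≢1+n (sym eq))
index-injective p {suc y} {suc z} py pz eq =
  cong suc (index-injective (p ∘ suc) py pz (+-cancelˡ-≡ (indicator (p zero)) _ _ eq))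

enumerate : ∀ {n} (p : Fin n → Bool) r → r < count p → Σ[ y ∈ Fin n ] p y ≡ true × index p y ≡ r
enumerate {suc n} p r r<count with p zero in p0
enumerate {suc n} p zero    _       | true = zero , p0 , refl
enumerate {suc n} p (suc r) r<count | true with enumerate (p ∘ suc) r (≤-pred r<count)
... | y , py , index≡r = suc y , py , trans (cong (λ b → indicator b + index (p ∘ suc) y) p0) (cong suc index≡r)
enumerate {suc n} p r r<count | false with enumerate (p ∘ suc) r r<count
... | y , py , index≡r = suc y , py , trans (cong (λ b → indicator b + index (p ∘ suc) y) p0) index≡r

injection⇒≤-count : ∀ {n d} (p : Fin n → Bool) {e : Fin d → Fin n} →
  Injective _≡_ _≡_ e → (∀ j → p (e j) ≡ true) → d ≤ count p
injection⇒≤-count p {e} e-inj pe =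
  injective-below⇒≤ (index p ∘ e) (λ j → index<count p (e j) (pe j))
    (λ {j} {j'} eq → e-inj (index-injective p (pe j) (pe j') eq))

≤-count⇒injection : ∀ {n} d (p : Fin n → Bool) → d ≤ count p →
  Σ[ e ∈ (Fin d → Fin n) ] Injective _≡_ _≡_ e × (∀ j → p (e j) ≡ true)
≤-count⇒injection d p d≤count = proj₁ ∘ pick , pick-injective , proj₁ ∘ proj₂ ∘ pick
  where
  pick : (j : Fin d) → Σ[ y ∈ _ ] p y ≡ true × index p y ≡ toℕ j
  pick j = enumerate p (toℕ j) (<-≤-trans (toℕ<n j) d≤count)
  pick-injective : Injective _≡_ _≡_ (proj₁ ∘ pick)
  pick-injective {j} {j'} eq = toℕ-injective
    (trans (sym (proj₂ (proj₂ (pick j)))) (trans (cong (index p) eq) (proj₂ (proj₂ (pick j')))))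

count≤suc-count-remove : ∀ {n} (p : Fin n → Bool) x → count p ≤ suc (count (λ y → p y ∧ not (does (y ≟ᶠ x))))
count≤suc-count-remove {suc n} p zero rewrite ∧-zeroʳ (p zero) with p zero
... | true  = ≤-reflexive (cong suc (count-cong (λ y → sym (∧-identityʳ (p (suc y))))))
... | false = m≤n⇒m≤1+n (≤-reflexive (count-cong (λ y → sym (∧-identityʳ (p (suc y))))))
count≤suc-count-remove {suc n} p (suc x) rewrite ∧-identityʳ (p zero) with p zero | count≤suc-count-remove (p ∘ suc) x
... | true  | ih = s≤s ih
... | false | ih = ih

indicator-split : ∀ {t} b (j : Fin t) → indicator b ≡ sum (λ i → indicator (b ∧ does (j ≟ᶠ i)))
indicator-split {t} false j = sym (sum-zero t)
indicator-split {suc t} true zero = cong suc (sym (sum-zero t))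
indicator-split true (suc j) = indicator-split true j

count-partition : ∀ {n t} (p : Fin n → Bool) (f : Fin n → Fin t) →
  count p ≡ sum (λ i → count (λ y → p y ∧ does (f y ≟ᶠ i)))
count-partition {n} {t} p f = trans (sum-cong-≗ (λ y → indicator-split (p y) (f y))) (∑-comm {n} {t} _)

start : ∀ {t} → (Fin t → ℕ) → Fin t → ℕ
start w zero    = 0
start w (suc i) = w zero + start (w ∘ suc) i

locate : ∀ {t} → (Fin (suc t) → ℕ) → ℕ → Fin (suc t) × ℕ
locate {zero}  w c = zero , c
locate {suc t} w c with c <? w zero
... | yes _ = zero , c
... | no  _ = let (i , r) = locate (w ∘ suc) (c ∸ w zero) in suc i , r

block : ∀ {t} → (Fin (suc t) → ℕ) → ℕ → Fin (suc t)
block w c = proj₁ (locate w c)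

offset : ∀ {t} → (Fin (suc t) → ℕ) → ℕ → ℕ
offset w c = proj₂ (locate w c)

locate-correct : ∀ {t} (w : Fin (suc t) → ℕ) c → c < sum w →
  offset w c < w (block w c) × start w (block w c) + offset w c ≡ c
locate-correct {zero}  w c c<sum = subst (c <_) (+-identityʳ (w zero)) c<sum , refl
locate-correct {suc t} w c c<sum with c <? w zero
... | yes c<w₀ = c<w₀ , refl
... | no  c≮w₀ with locate-correct (w ∘ suc) (c ∸ w zero) (∸-<-sum (≮⇒≥ c≮w₀))
  where
  ∸-<-sum : w zero ≤ c → c ∸ w zero < sum (w ∘ suc)
  ∸-<-sum w₀≤c = subst (c ∸ w zero <_) (m+n∸m≡n (w zero) _) (∸-monoˡ-< c<sum w₀≤c)
...   | r<w , start+r≡ =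
  r<w , trans (+-assoc (w zero) _ _) (trans (cong (w zero +_) start+r≡) (m+[n∸m]≡n (≮⇒≥ c≮w₀)))

locate-injective : ∀ {t} (w : Fin (suc t) → ℕ) {c c'} → c < sum w → c' < sum w →
  block w c ≡ block w c' → offset w c ≡ offset w c' → c ≡ c'
locate-injective w {c} {c'} c<sum c'<sum block≡ offset≡ =
  trans (sym (proj₂ (locate-correct w c c<sum)))
    (trans (cong₂ (λ i r → start w i + r) block≡ offset≡) (proj₂ (locate-correct w c' c'<sum)))

-- Upper bounds

module _ {n t : ℕ} (G : Graph n) (c : Colouring n t) where

  colourClass : Fin n → Fin t → Fin n → Bool
  colourClass v i y = adj G v y ∧ does (col c v y ≟ᶠ i)

  colourClass-sym : ∀ i u v → colourClass u i v ≡ colourClass v i u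
  colourClass-sym i u v rewrite adj-sym G u v | col-sym c u v = refl

  colourClass-irrefl : ∀ i v → colourClass v i v ≡ false
  colourClass-irrefl i v rewrite adj-irrefl G v = refl

  degree-partition : ∀ v → count (adj G v) ≡ sum (count ∘ colourClass v)
  degree-partition v = count-partition (adj G v) (col c v)

  monoStar-of-≤-count : ∀ v i k → k ≤ count (colourClass v i) → MonoStar G c i k
  monoStar-of-≤-count v i k k≤count with ≤-count⇒injection k (colourClass v i) k≤count
  ... | e , e-inj , in-class = v , e , e-inj , λ j →
    let (adj≡ , col≡) = ∧-≡-true (in-class j) in adj≡ , does-≡-true (col c v (e j) ≟ᶠ i) col≡

handshake : ∀ {n} (a : Fin n → Fin n → Bool) → (∀ u v → a u v ≡ a v u) → (∀ v → a v v ≡ false) →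
  2 ∣ sum (count ∘ a)
handshake {zero}  a a-sym a-irrefl = divides 0 refl
handshake {suc n} a a-sym a-irrefl =
  subst (2 ∣_) (sym split) (∣m∣n⇒∣m+n 2∣R+R (handshake a′ (λ u v → a-sym (suc u) (suc v)) (a-irrefl ∘ suc)))
  where
  a′ : Fin n → Fin n → Bool
  a′ u v = a (suc u) (suc v)
  R : ℕ
  R = count (a zero ∘ suc)
  2∣R+R : 2 ∣ R + R
  2∣R+R = divides R (trans (cong (R +_) (sym (+-identityʳ R))) (*-comm 2 R))
  split : sum (count ∘ a) ≡ R + R + sum (count ∘ a′)
  split = begin
    indicator (a zero zero) + R + sum (λ v → indicator (a (suc v) zero) + count (a′ v))
      ≡⟨ cong (λ b → indicator b + R + sum (λ v → indicator (a (suc v) zero) + count (a′ v))) (a-irrefl zero) ⟩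
    R + sum (λ v → indicator (a (suc v) zero) + count (a′ v))
      ≡⟨ cong (R +_) (∑-distrib-+ (λ v → indicator (a (suc v) zero)) (count ∘ a′)) ⟩
    R + (count (λ v → a (suc v) zero) + sum (count ∘ a′))
      ≡⟨ cong (λ x → R + (x + sum (count ∘ a′))) (count-cong (λ v → a-sym (suc v) zero)) ⟩
    R + (R + sum (count ∘ a′))
      ≡⟨ sym (+-assoc R R _) ⟩
    R + R + sum (count ∘ a′) ∎
    where open ≡-Reasoning

2-is-prime : Prime 2
2-is-prime = from-yes (prime? 2)

module _ {n t : ℕ} (G : Graph n) {m w : Fin t → ℕ} (m≡suc-w : ∀ i → m i ≡ suc (w i)) where

  private
    small-classes : (c : Colouring n t) → ¬ (∃ λ v → ∃ λ i → m i ≤ count (colourClass G c v i)) →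
      ∀ v i → count (colourClass G c v i) ≤ w i
    small-classes c none v i = s≤s⁻¹ (subst (_ <_) (m≡suc-w i) (≰⇒> λ m≤ → none (v , i , m≤)))

    star-or-small : (c : Colouring n t) →
      (∃ λ i → MonoStar G c i (m i)) ⊎ (∀ v i → count (colourClass G c v i) ≤ w i)
    star-or-small c with any? (λ v → any? (λ i → m i ≤? count (colourClass G c v i)))
    ... | yes (v , i , m≤count) = inj₁ (i , monoStar-of-≤-count G c v i (m i) m≤count)
    ... | no  none              = inj₂ (small-classes c none)

    degree≤sum : (c : Colouring n t) → (∀ v i → count (colourClass G c v i) ≤ w i) →
      ∀ v → count (adj G v) ≤ sum w
    degree≤sum c small v = ≤-trans (≤-reflexive (degree-partition G c v)) (sum-mono-≤ (small v))

  arrows-of-degree> : ∀ v → sum w < count (adj G v) → Arrows G m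
  arrows-of-degree> v Σw<deg c with star-or-small c
  ... | inj₁ star  = star
  ... | inj₂ small = ⊥-elim (<⇒≱ Σw<deg (degree≤sum c small v))

  -- Without a star every colour class i₀ is exactly w i₀-regular,
  -- which the handshake lemma forbids for n and w i₀ odd.
  arrows-of-odd-degree≥ : ¬ 2 ∣ n → ∀ i₀ → ¬ 2 ∣ w i₀ → (∀ v → sum w ≤ count (adj G v)) → Arrows G m
  arrows-of-odd-degree≥ n-odd i₀ w-odd Σw≤deg c with star-or-small c
  ... | inj₁ star  = star
  ... | inj₂ small = contradiction
    (handshake (λ v → colourClass G c v i₀) (colourClass-sym G c i₀) (colourClass-irrefl G c i₀)) odd-total
    where
    class≡w : ∀ v → count (colourClass G c v i₀) ≡ w i₀
    class≡w v = sum-≤-squeeze (small v) (≤-trans (Σw≤deg v) (≤-reflexive (degree-partition G c v))) i₀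
    odd-total : ¬ 2 ∣ sum (λ v → count (colourClass G c v i₀))
    odd-total 2∣total = [ n-odd , w-odd ]′ (euclidsLemma n (w i₀) 2-is-prime
      (subst (2 ∣_) (trans (sum-cong-≗ class≡w) (sum-const n (w i₀))) 2∣total))

-- Colourings without monochromatic stars

module _ {n t : ℕ} (G : Graph n) {m w : Fin t → ℕ} (w<m : ∀ i → w i < m i) where

  ¬arrows-of-positions : (c : Colouring n t) (pos : Fin n → Fin n → ℕ) →
    (∀ x y → adj G x y ≡ true → pos x y < w (col c x y)) →
    (∀ x {y z} → adj G x y ≡ true → adj G x z ≡ true → col c x y ≡ col c x z → pos x y ≡ pos x z → y ≡ z) →
    ¬ Arrows G m
  ¬arrows-of-positions c pos pos<w pos-inj arrows with arrows c
  ... | i , v , e , e-inj , star = <⇒≱ (w<m i) (injective-below⇒≤ (pos v ∘ e) pos<wᵢ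
          λ {j} {j'} eq → e-inj (pos-inj v (proj₁ (star j)) (proj₁ (star j'))
                                  (trans (proj₂ (star j)) (sym (proj₂ (star j')))) eq))
    where
    pos<wᵢ : ∀ j → pos v (e j) < w i
    pos<wᵢ j = subst (λ i → pos v (e j) < w i) (proj₂ (star j)) (pos<w v (e j) (proj₁ (star j)))

module _ {n t : ℕ} (G : Graph n) {m w : Fin (suc t) → ℕ} (w<m : ∀ i → w i < m i) where

  ¬arrows-of-label : (label : Fin n → Fin n → ℕ) → (∀ x y → label x y ≡ label y x) →
    (∀ x y → adj G x y ≡ true → label x y < sum w) →
    (∀ x {y z} → adj G x y ≡ true → adj G x z ≡ true → label x y ≡ label x z → y ≡ z) →
    ¬ Arrows G m
  ¬arrows-of-label label label-sym label<sum label-inj =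
    ¬arrows-of-positions G w<m blockColouring (λ x y → offset w (label x y))
      (λ x y xy → proj₁ (locate-correct w (label x y) (label<sum x y xy)))
      (λ x xy xz block≡ offset≡ → label-inj x xy xz (locate-injective w (label<sum _ _ xy) (label<sum _ _ xz) block≡ offset≡))
    where
    blockColouring : Colouring n (suc t)
    blockColouring = record { col = λ x y → block w (label x y) ; col-sym = λ x y → cong (block w) (label-sym x y) }

module Threshold {n : ℕ} (label : Fin n → Fin n → ℕ) (label-sym : ∀ x y → label x y ≡ label y x) where

  graph : ℕ → Graph n
  graph s = record
    { adj        = λ x y → not (does (x ≟ᶠ y)) ∧ does (label x y <? s)
    ; adj-sym    = λ x y → cong₂ (λ a b → not a ∧ b) (does-⇔ (mk⇔ sym sym) (x ≟ᶠ y) (y ≟ᶠ x))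
                                                      (cong (λ l → does (l <? s)) (label-sym x y))
    ; adj-irrefl = λ x → cong (λ a → not a ∧ does (label x x <? s)) (dec-true (x ≟ᶠ x) refl)
    }

  module _ {s : ℕ} where

    adj⇒ : ∀ {x y} → adj (graph s) x y ≡ true → y ≢ x × label x y < s
    adj⇒ {x} {y} xy = let (x≢y , l<s) = ∧-≡-true xy in
      not-does-≡-true (x ≟ᶠ y) x≢y ∘ sym , does-≡-true (label x y <? s) l<s

    adj⇐ : ∀ {x y} → y ≢ x → label x y < s → adj (graph s) x y ≡ true
    adj⇐ {x} {y} y≢x l<s = ∧-intro (cong not (dec-false (x ≟ᶠ y) (y≢x ∘ sym))) (dec-true (label x y <? s) l<s)

    degree≥ : ∀ x {d} (e : Fin d → Fin n) → Injective _≡_ _≡_ e → (∀ j → e j ≢ x) → (∀ j → label x (e j) < s) →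
      d ≤ count (adj (graph s) x)
    degree≥ x e e-inj e≢x l<s = injection⇒≤-count (adj (graph s) x) e-inj (λ j → adj⇐ (e≢x j) (l<s j))

    private
      choose : ∀ x {P : Fin n → Set} → (∀ {c} → c < s → Σ[ y ∈ Fin n ] P y × label x y ≡ c) → Fin s → Fin n
      choose x pre j = proj₁ (pre (toℕ<n j))

      choose-injective : ∀ x {P : Fin n → Set} (pre : ∀ {c} → c < s → Σ[ y ∈ Fin n ] P y × label x y ≡ c) →
        Injective _≡_ _≡_ (choose x pre)
      choose-injective x pre {j} {j'} eq = toℕ-injective
        (trans (sym (proj₂ (proj₂ (pre (toℕ<n j))))) (trans (cong (label x) eq) (proj₂ (proj₂ (pre (toℕ<n j'))))))

      choose-below : ∀ x {P : Fin n → Set} (pre : ∀ {c} → c < s → Σ[ y ∈ Fin n ] P y × label x y ≡ c) →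
        ∀ j → label x (choose x pre j) < s
      choose-below x pre j = subst (_< s) (sym (proj₂ (proj₂ (pre (toℕ<n j))))) (toℕ<n j)

    degree≥-of-preimages : ∀ x → (∀ {c} → c < s → Σ[ y ∈ Fin n ] y ≢ x × label x y ≡ c) → s ≤ count (adj (graph s) x)
    degree≥-of-preimages x pre =
      degree≥ x (choose x pre) (choose-injective x pre) (λ j → proj₁ (proj₂ (pre (toℕ<n j)))) (choose-below x pre)

    -- x itself may be the preimage of one label, hence the loss of one.
    degree≥∸1-of-preimages : ∀ x → (∀ {c} → c < s → Σ[ y ∈ Fin n ] ⊤ × label x y ≡ c) → s ∸ 1 ≤ count (adj (graph s) x)
    degree≥∸1-of-preimages x pre = begin
      s ∸ 1            ≤⟨ ∸-monoˡ-≤ 1 (injection⇒≤-count below (choose-injective x pre)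
                            (λ j → dec-true (label x _ <? s) (choose-below x pre j))) ⟩
      count below ∸ 1  ≤⟨ ∸-monoˡ-≤ 1 (count≤suc-count-remove below x) ⟩
      count (λ y → below y ∧ not (does (y ≟ᶠ x)))
        ≡⟨ count-cong (λ y → trans (∧-comm (below y) _)
                                   (cong (λ a → not a ∧ below y) (does-⇔ (mk⇔ sym sym) (y ≟ᶠ x) (x ≟ᶠ y)))) ⟩
      count (adj (graph s) x) ∎
      where
      open ≤-Reasoning
      below : Fin n → Bool
      below y = does (label x y <? s)

  ¬arrows : ∀ {t} {m w : Fin (suc t) → ℕ} → (∀ i → w i < m i) →
    (∀ x {y z} → y ≢ x → z ≢ x → label x y ≡ label x z → y ≡ z) → ¬ Arrows (graph (sum w)) m
  ¬arrows {w = w} w<m label-inj = ¬arrows-of-label (graph (sum w)) w<m label label-sym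
    (λ x y xy → proj₂ (adj⇒ {sum w} xy))
    (λ x xy xz → label-inj x (proj₁ (adj⇒ {sum w} xy)) (proj₁ (adj⇒ {sum w} xz)))

module _ (q : ℕ) .{{_ : NonZero q}} where

  [m%q+n]%q≡[m+n]%q : ∀ a b → (a % q + b) % q ≡ (a + b) % q
  [m%q+n]%q≡[m+n]%q a b = begin
    (a % q + b) % q         ≡⟨ %-distribˡ-+ (a % q) b q ⟩
    (a % q % q + b % q) % q ≡⟨ cong (λ z → (z + b % q) % q) (m%n%n≡m%n a q) ⟩
    (a % q + b % q) % q     ≡⟨ %-distribˡ-+ a b q ⟨
    (a + b) % q             ∎
    where open ≡-Reasoning

  [m+n%q]%q≡[m+n]%q : ∀ a b → (a + b % q) % q ≡ (a + b) % q
  [m+n%q]%q≡[m+n]%q a b = begin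
    (a + b % q) % q ≡⟨ cong (_% q) (+-comm a (b % q)) ⟩
    (b % q + a) % q ≡⟨ [m%q+n]%q≡[m+n]%q b a ⟩
    (b + a) % q     ≡⟨ cong (_% q) (+-comm b a) ⟩
    (a + b) % q     ∎
    where open ≡-Reasoning

  [m*[n%q]]%q≡[m*n]%q : ∀ a b → (a * (b % q)) % q ≡ (a * b) % q
  [m*[n%q]]%q≡[m*n]%q a b = begin
    (a * (b % q)) % q           ≡⟨ %-distribˡ-* a (b % q) q ⟩
    (a % q * (b % q % q)) % q   ≡⟨ cong (λ z → (a % q * z) % q) (m%n%n≡m%n b q) ⟩
    (a % q * (b % q)) % q       ≡⟨ %-distribˡ-* a b q ⟨
    (a * b) % q                 ∎
    where open ≡-Reasoning

  unshift-shift : ∀ {a y} → a ≤ q → y < q → ((a + y) % q + (q ∸ a)) % q ≡ y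
  unshift-shift {a} {y} a≤q y<q = begin
    ((a + y) % q + (q ∸ a)) % q ≡⟨ [m%q+n]%q≡[m+n]%q (a + y) (q ∸ a) ⟩
    (a + y + (q ∸ a)) % q       ≡⟨ cong (_% q) (trans (cong (_+ (q ∸ a)) (+-comm a y)) (+-assoc y a (q ∸ a))) ⟩
    (y + (a + (q ∸ a))) % q     ≡⟨ cong (λ z → (y + z) % q) (m+[n∸m]≡n a≤q) ⟩
    (y + q) % q                 ≡⟨ [m+n]%n≡m%n y q ⟩
    y % q                       ≡⟨ m<n⇒m%n≡m y<q ⟩
    y                           ∎
    where open ≡-Reasoning

  shift-unshift : ∀ {a z} → a ≤ q → z < q → (a + (z + (q ∸ a)) % q) % q ≡ z
  shift-unshift {a} {z} a≤q z<q = begin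
    (a + (z + (q ∸ a)) % q) % q ≡⟨ [m+n%q]%q≡[m+n]%q a (z + (q ∸ a)) ⟩
    (a + (z + (q ∸ a))) % q     ≡⟨ cong (_% q) (trans (cong (a +_) (+-comm z (q ∸ a))) (sym (+-assoc a (q ∸ a) z))) ⟩
    (a + (q ∸ a) + z) % q       ≡⟨ cong (λ x → (x + z) % q) (m+[n∸m]≡n a≤q) ⟩
    (q + z) % q                 ≡⟨ cong (_% q) (+-comm q z) ⟩
    (z + q) % q                 ≡⟨ [m+n]%n≡m%n z q ⟩
    z % q                       ≡⟨ m<n⇒m%n≡m z<q ⟩
    z                           ∎
    where open ≡-Reasoning

  shift-injective : ∀ {a y y'} → a ≤ q → y < q → y' < q → (a + y) % q ≡ (a + y') % q → y ≡ y'
  shift-injective {a} a≤q y<q y'<q eq =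
    trans (sym (unshift-shift a≤q y<q)) (trans (cong (λ z → (z + (q ∸ a)) % q) eq) (unshift-shift a≤q y'<q))

module _ (u : ℕ) where

  open +-*-Solver using (solve; _:+_; _:*_; _:=_; con)

  private
    q : ℕ
    q = suc (2 * u)

  -- suc u is the inverse of 2 modulo the odd number q.
  half-double : ∀ {y} → y < q → (suc u * ((2 * y) % q)) % q ≡ y
  half-double {y} y<q = begin
    (suc u * ((2 * y) % q)) % q ≡⟨ [m*[n%q]]%q≡[m*n]%q q (suc u) (2 * y) ⟩
    (suc u * (2 * y)) % q       ≡⟨ cong (_% q)
                                     (solve 2 (λ u y → (con 1 :+ u) :* (con 2 :* y) := y :+ y :* (con 1 :+ con 2 :* u)) refl u y) ⟩
    (y + y * q) % q             ≡⟨ [m+kn]%n≡m%n y y q ⟩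
    y % q                       ≡⟨ m<n⇒m%n≡m y<q ⟩
    y                           ∎
    where open ≡-Reasoning

  double-half : ∀ {c} → c < q → (2 * ((suc u * c) % q)) % q ≡ c
  double-half {c} c<q = begin
    (2 * ((suc u * c) % q)) % q ≡⟨ [m*[n%q]]%q≡[m*n]%q q 2 (suc u * c) ⟩
    (2 * (suc u * c)) % q       ≡⟨ cong (_% q)
                                     (solve 2 (λ u c → con 2 :* ((con 1 :+ u) :* c) := c :+ c :* (con 1 :+ con 2 :* u)) refl u c) ⟩
    (c + c * q) % q             ≡⟨ [m+kn]%n≡m%n c c q ⟩
    c % q                       ≡⟨ m<n⇒m%n≡m c<q ⟩
    c                           ∎
    where open ≡-Reasoning

two-digits-injective : ∀ {a a' b b'} → b < 2 → b' < 2 → b + 2 * a ≡ b' + 2 * a' → b ≡ b' × a ≡ a'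
two-digits-injective {a} {a'} {b} {b'} b<2 b'<2 eq =
  b≡b' , *-cancelˡ-≡ a a' 2 (+-cancelˡ-≡ b _ _ (trans eq (cong (_+ 2 * a') (sym b≡b'))))
  where
  mod2 : ∀ {a b} → b < 2 → (b + 2 * a) % 2 ≡ b
  mod2 {a} {b} b<2 = trans (cong (λ z → (b + z) % 2) (*-comm 2 a)) (trans ([m+kn]%n≡m%n b a 2) (m<n⇒m%n≡m b<2))
  b≡b' : b ≡ b'
  b≡b' = trans (sym (mod2 {a} b<2)) (trans (cong (_% 2) eq) (mod2 {a'} b'<2))

two-digits-< : ∀ {a b W} → b < 2 → a < W → b + 2 * a < 2 * W
two-digits-< {a} {b} {W} b<2 a<W = begin-strict
  b + 2 * a     <⟨ +-monoˡ-< (2 * a) b<2 ⟩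
  2 + 2 * a     ≡⟨ *-suc 2 a ⟨
  2 * suc a     ≤⟨ *-monoʳ-≤ 2 a<W ⟩
  2 * W         ∎
  where open ≤-Reasoning

parity-split : ∀ n → (∃ λ h → n ≡ 2 * h) ⊎ (∃ λ h → n ≡ suc (2 * h))
parity-split zero = inj₁ (0 , refl)
parity-split (suc n) with parity-split n
... | inj₁ (h , refl) = inj₂ (h , refl)
... | inj₂ (h , refl) = inj₁ (suc h , sym (*-suc 2 h))

¬2∣suc-2* : ∀ h → ¬ 2 ∣ suc (2 * h)
¬2∣suc-2* h (divides q eq) = even≢odd q h (trans (*-comm 2 q) (sym eq))

odd⇒≡suc-2* : ∀ {n} → ¬ 2 ∣ n → ∃ λ h → n ≡ suc (2 * h)
odd⇒≡suc-2* {n} n-odd with parity-split n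
... | inj₁ (h , eq) = ⊥-elim (n-odd (divides h (trans eq (*-comm 2 h))))
... | inj₂ odd      = odd

-- Three labellings

module SumLabelling (q : ℕ) .{{_ : NonZero q}} where

  label : Fin q → Fin q → ℕ
  label x y = (toℕ x + toℕ y) % q

  label-sym : ∀ x y → label x y ≡ label y x
  label-sym x y = cong (_% q) (+-comm (toℕ x) (toℕ y))

  label<q : ∀ x y → label x y < q
  label<q x y = m%n<n (toℕ x + toℕ y) q

  label-injective : ∀ x {y z} → label x y ≡ label x z → y ≡ z
  label-injective x {y} {z} eq = toℕ-injective (shift-injective q (<⇒≤ (toℕ<n x)) (toℕ<n y) (toℕ<n z) eq)

  preimage : Fin q → ℕ → Fin q
  preimage x c = fromℕ< (m%n<n (c + (q ∸ toℕ x)) q)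

  label-preimage : ∀ x {c} → c < q → label x (preimage x c) ≡ c
  label-preimage x {c} c<q =
    trans (cong (λ y → (toℕ x + y) % q) (toℕ-fromℕ< (m%n<n (c + (q ∸ toℕ x)) q))) (shift-unshift q (<⇒≤ (toℕ<n x)) c<q)

-- The 1-factorisation of K_{q+1}: vertex zero plays the role of ∞ and suc x that of x ∈ ℤ_q.
module RoundRobin (u : ℕ) where

  q : ℕ
  q = suc (2 * u)

  open SumLabelling q using () renaming (label to sumLabel)

  label : Fin (suc q) → Fin (suc q) → ℕ
  label zero    zero    = 0
  label zero    (suc y) = (2 * toℕ y) % q
  label (suc x) zero    = (2 * toℕ x) % q
  label (suc x) (suc y) = sumLabel x y

  label-sym : ∀ x y → label x y ≡ label y x
  label-sym zero    zero    = refl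
  label-sym zero    (suc y) = refl
  label-sym (suc x) zero    = refl
  label-sym (suc x) (suc y) = SumLabelling.label-sym q x y

  private
    double≡sum : ∀ (x : Fin q) → (2 * toℕ x) % q ≡ sumLabel x x
    double≡sum x = cong (λ z → (toℕ x + z) % q) (+-identityʳ (toℕ x))

    double-injective : ∀ {y z : Fin q} → (2 * toℕ y) % q ≡ (2 * toℕ z) % q → y ≡ z
    double-injective {y} {z} eq = toℕ-injective
      (trans (sym (half-double u (toℕ<n y))) (trans (cong (λ c → (suc u * c) % q) eq) (half-double u (toℕ<n z))))

  label-injective : ∀ x {y z} → y ≢ x → z ≢ x → label x y ≡ label x z → y ≡ z
  label-injective zero    {zero}  {_}     y≢x _   _  = ⊥-elim (y≢x refl)
  label-injective zero    {suc _} {zero}  _   z≢x _  = ⊥-elim (z≢x refl)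
  label-injective zero    {suc y} {suc z} _   _   eq = cong suc (double-injective eq)
  label-injective (suc x) {zero}  {zero}  _   _   _  = refl
  label-injective (suc x) {zero}  {suc z} _   z≢x eq =
    ⊥-elim (z≢x (cong suc (sym (SumLabelling.label-injective q x (trans (sym (double≡sum x)) eq)))))
  label-injective (suc x) {suc y} {zero}  y≢x _   eq =
    ⊥-elim (y≢x (cong suc (SumLabelling.label-injective q x (trans eq (double≡sum x)))))
  label-injective (suc x) {suc y} {suc z} _   _   eq = cong suc (SumLabelling.label-injective q x eq)

  preimage : ∀ x {c} → c < q → Σ[ y ∈ Fin (suc q) ] y ≢ x × label x y ≡ c
  preimage zero {c} c<q = suc half , (λ ()) , trans (cong (λ h → (2 * h) % q) (toℕ-fromℕ< half<q)) (double-half u c<q)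
    where
    half<q : (suc u * c) % q < q
    half<q = m%n<n (suc u * c) q
    half : Fin q
    half = fromℕ< half<q
  preimage (suc x) {c} c<q with SumLabelling.preimage q x c ≟ᶠ x
  ... | yes y≡x = zero , (λ ()) ,
        trans (double≡sum x) (trans (cong (sumLabel x) (sym y≡x)) (SumLabelling.label-preimage q x c<q))
  ... | no  y≢x = suc (SumLabelling.preimage q x c) , y≢x ∘ fsuc-injective , SumLabelling.label-preimage q x c<q

module Circulant (u : ℕ) where

  N : ℕ
  N = suc (2 * u)

  diff : ℕ → ℕ → ℕ
  diff X Y = (Y + (N ∸ X)) % N

  module _ {X : ℕ} (X<N : X < N) where

    diff<N : ∀ Y → diff X Y < N
    diff<N Y = m%n<n (Y + (N ∸ X)) N

    +-diff : ∀ {Y} → Y < N → (X + diff X Y) % N ≡ Y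
    +-diff Y<N = shift-unshift N (<⇒≤ X<N) Y<N

    diff-+ : ∀ {D} → D < N → diff X ((X + D) % N) ≡ D
    diff-+ D<N = unshift-shift N (<⇒≤ X<N) D<N

    diff-self : diff X X ≡ 0
    diff-self = trans (cong (_% N) (m+[n∸m]≡n (<⇒≤ X<N))) (n%n≡0 N)

    diff≡0⇒≡ : ∀ {Y} → Y < N → diff X Y ≡ 0 → X ≡ Y
    diff≡0⇒≡ {Y} Y<N D≡0 = begin
      X                  ≡⟨ m<n⇒m%n≡m X<N ⟨
      X % N              ≡⟨ cong (_% N) (+-identityʳ X) ⟨
      (X + 0) % N        ≡⟨ cong (λ d → (X + d) % N) D≡0 ⟨
      (X + diff X Y) % N ≡⟨ +-diff Y<N ⟩
      Y                  ∎
      where open ≡-Reasoning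

    diff-swap : ∀ {Y} → Y < N → X ≢ Y → diff Y X ≡ N ∸ diff X Y
    diff-swap {Y} Y<N X≢Y = shift-injective N (<⇒≤ Y<N) (m%n<n (X + (N ∸ Y)) N) N∸D<N
      (trans (shift-unshift N (<⇒≤ Y<N) X<N) (sym Y+N∸D))
      where
      D = diff X Y
      N∸D<N : N ∸ D < N
      N∸D<N = ∸-monoʳ-< (n≢0⇒n>0 (X≢Y ∘ diff≡0⇒≡ Y<N)) (<⇒≤ (diff<N Y))
      Y+N∸D : (Y + (N ∸ D)) % N ≡ X
      Y+N∸D = begin
        (Y + (N ∸ D)) % N               ≡⟨ cong (λ y → (y + (N ∸ D)) % N) (+-diff Y<N) ⟨
        ((X + D) % N + (N ∸ D)) % N     ≡⟨ cong (λ z → (z % N + (N ∸ D)) % N) (+-comm X D) ⟩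
        ((D + X) % N + (N ∸ D)) % N     ≡⟨ unshift-shift N (<⇒≤ (diff<N Y)) X<N ⟩
        X                               ∎
        where open ≡-Reasoning

  private
    suc<N : ∀ {h} → h < u → suc h < N
    suc<N h<u = s≤s (≤-trans h<u (m≤m+n u _))

    N≡suc-u+u : N ≡ suc u + u
    N≡suc-u+u = cong (λ z → suc (u + z)) (+-identityʳ u)

    ≤u⇒u<N∸ : ∀ {D} → D ≤ u → u < N ∸ D
    ≤u⇒u<N∸ {D} D≤u = ≤-trans (≤-reflexive (sym (trans (cong (_∸ u) N≡suc-u+u) (m+n∸n≡m (suc u) u)))) (∸-monoʳ-≤ N D≤u)

    u<⇒N∸≤u : ∀ {D} → u < D → N ∸ D ≤ u
    u<⇒N∸≤u {D} u<D = ≤-trans (∸-monoʳ-≤ N u<D) (≤-reflexive (trans (cong (_∸ suc u) N≡suc-u+u) (m+n∸m≡n (suc u) u)))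

  -- D and N ∸ D are the two differences of a pair at circular distance dist D;
  -- side D tells which one D is.
  dist : ℕ → ℕ
  dist D with D ≤? u
  ... | yes _ = D
  ... | no  _ = N ∸ D

  side : ℕ → ℕ
  side D with D ≤? u
  ... | yes _ = 0
  ... | no  _ = 1

  unfold : ℕ → ℕ → ℕ
  unfold d zero    = d
  unfold d (suc _) = N ∸ d

  side<2 : ∀ D → side D < 2
  side<2 D with D ≤? u
  ... | yes _ = s≤s z≤n
  ... | no  _ = s≤s (s≤s z≤n)

  dist≥1 : ∀ {D} → 1 ≤ D → D < N → 1 ≤ dist D
  dist≥1 {D} 1≤D D<N with D ≤? u
  ... | yes _ = 1≤D
  ... | no  _ = m<n⇒0<n∸m D<N

  unfold-fold : ∀ {D} → D < N → unfold (dist D) (side D) ≡ D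
  unfold-fold {D} D<N with D ≤? u
  ... | yes _ = refl
  ... | no  _ = m∸[m∸n]≡n (<⇒≤ D<N)

  dist-flip : ∀ {D} → D < N → dist (N ∸ D) ≡ dist D
  dist-flip {D} D<N with D ≤? u | N ∸ D ≤? u
  ... | yes D≤u | yes N∸D≤u = ⊥-elim (<⇒≱ (≤u⇒u<N∸ D≤u) N∸D≤u)
  ... | yes _   | no  _     = m∸[m∸n]≡n (<⇒≤ D<N)
  ... | no  _   | yes _     = refl
  ... | no  D≰u | no  N∸D≰u = ⊥-elim (N∸D≰u (u<⇒N∸≤u (≰⇒> D≰u)))

  fold-unfold : ∀ {h b} → h < u → b < 2 → dist (unfold (suc h) b) ≡ suc h × side (unfold (suc h) b) ≡ b
  fold-unfold {h} {zero} h<u _ with suc h ≤? u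
  ... | yes _   = refl , refl
  ... | no  h≮u = ⊥-elim (h≮u h<u)
  fold-unfold {h} {suc zero} h<u _ with N ∸ suc h ≤? u
  ... | yes N∸≤u = ⊥-elim (<⇒≱ (≤u⇒u<N∸ h<u) N∸≤u)
  ... | no  _    = m∸[m∸n]≡n (<⇒≤ (suc<N h<u)) , refl
  fold-unfold {h} {suc (suc _)} _ (s≤s (s≤s ()))

  unfold-bounds : ∀ {h} b → h < u → 1 ≤ unfold (suc h) b × unfold (suc h) b < N
  unfold-bounds zero    h<u = s≤s z≤n , suc<N h<u
  unfold-bounds (suc _) h<u = m<n⇒0<n∸m (suc<N h<u) , ∸-monoʳ-< (s≤s z≤n) (<⇒≤ (suc<N h<u))

  label : Fin N → Fin N → ℕ
  label x y = dist (diff (toℕ x) (toℕ y)) ∸ 1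

  label-sym : ∀ x y → label x y ≡ label y x
  label-sym x y with toℕ x ≟ toℕ y
  ... | yes X≡Y = cong₂ (λ X Y → dist (diff X Y) ∸ 1) X≡Y (sym X≡Y)
  ... | no  X≢Y = cong (_∸ 1)
    (trans (sym (dist-flip (diff<N (toℕ<n x) (toℕ y)))) (cong dist (sym (diff-swap (toℕ<n x) (toℕ<n y) X≢Y))))

  module _ {x : Fin N} where

    private
      X = toℕ x

    diff≥1 : ∀ {y} → y ≢ x → 1 ≤ diff X (toℕ y)
    diff≥1 {y} y≢x = n≢0⇒n>0 (λ D≡0 → y≢x (sym (toℕ-injective (diff≡0⇒≡ (toℕ<n x) (toℕ<n y) D≡0))))

    neighbour : ℕ → Fin N
    neighbour D = fromℕ< (m%n<n (X + D) N)

    diff-neighbour : ∀ {D} → D < N → diff X (toℕ (neighbour D)) ≡ D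
    diff-neighbour {D} D<N = trans (cong (diff X) (toℕ-fromℕ< (m%n<n (X + D) N))) (diff-+ (toℕ<n x) D<N)

    label-side-injective : ∀ {y z} → y ≢ x → z ≢ x → label x y ≡ label x z →
      side (diff X (toℕ y)) ≡ side (diff X (toℕ z)) → y ≡ z
    label-side-injective {y} {z} y≢x z≢x label≡ side≡ = toℕ-injective (begin
      toℕ y              ≡⟨ +-diff (toℕ<n x) (toℕ<n y) ⟨
      (X + Dy) % N       ≡⟨ cong (λ D → (X + D) % N) Dy≡Dz ⟩
      (X + Dz) % N       ≡⟨ +-diff (toℕ<n x) (toℕ<n z) ⟩
      toℕ z              ∎)
      where
      open ≡-Reasoning
      Dy = diff X (toℕ y)
      Dz = diff X (toℕ z)
      dist≡ : dist Dy ≡ dist Dz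
      dist≡ = ∸-cancelʳ-≡ (dist≥1 (diff≥1 y≢x) (diff<N (toℕ<n x) (toℕ y)))
                          (dist≥1 (diff≥1 z≢x) (diff<N (toℕ<n x) (toℕ z))) label≡
      Dy≡Dz : Dy ≡ Dz
      Dy≡Dz = trans (sym (unfold-fold (diff<N (toℕ<n x) (toℕ y))))
                (trans (cong₂ unfold dist≡ side≡) (unfold-fold (diff<N (toℕ<n x) (toℕ z))))

  module _ {t : ℕ} (w₂ : Fin (suc t) → ℕ) where

    open Threshold label label-sym using (adj⇒)

    graph : Graph N
    graph = Threshold.graph label label-sym (sum w₂)

    -- The two edges at x of a given circular distance, one on each side of x,
    -- are told apart by the last binary digit of pos.
    ¬arrows : ∀ {m} → (∀ i → 2 * w₂ i < m i) → ¬ Arrows graph m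
    ¬arrows w<m = ¬arrows-of-positions graph w<m colouring pos pos< pos-injective
      where
      colouring : Colouring N (suc t)
      colouring = record { col = λ x y → block w₂ (label x y) ; col-sym = λ x y → cong (block w₂) (label-sym x y) }
      pos : Fin N → Fin N → ℕ
      pos x y = side (diff (toℕ x) (toℕ y)) + 2 * offset w₂ (label x y)
      pos< : ∀ x y → adj graph x y ≡ true → pos x y < 2 * w₂ (block w₂ (label x y))
      pos< x y xy = two-digits-< (side<2 (diff (toℕ x) (toℕ y)))
        (proj₁ (locate-correct w₂ (label x y) (proj₂ (adj⇒ {sum w₂} {x} {y} xy))))
      pos-injective : ∀ x {y z} → adj graph x y ≡ true → adj graph x z ≡ true →
        block w₂ (label x y) ≡ block w₂ (label x z) → pos x y ≡ pos x z → y ≡ z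
      pos-injective x {y} {z} xy xz block≡ pos≡ with adj⇒ {sum w₂} {x} {y} xy | adj⇒ {sum w₂} {x} {z} xz
      ... | y≢x , y<S | z≢x , z<S =
        let (side≡ , offset≡) = two-digits-injective (side<2 (diff (toℕ x) (toℕ y))) (side<2 (diff (toℕ x) (toℕ z))) pos≡
        in label-side-injective y≢x z≢x (locate-injective w₂ y<S z<S block≡ offset≡) side≡

    degree≥ : sum w₂ ≤ u → ∀ x → 2 * sum w₂ ≤ count (adj graph x)
    degree≥ S≤u x = Threshold.degree≥ label label-sym x e e-injective e≢x e-below
      where
      S = sum w₂
      X = toℕ x
      half : Fin (2 * S) → ℕ
      half j = toℕ j / 2
      parity : Fin (2 * S) → ℕ
      parity j = toℕ j % 2
      half<S : ∀ j → half j < S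
      half<S j = m<n*o⇒m/o<n (subst (toℕ j <_) (*-comm 2 S) (toℕ<n j))
      half<u : ∀ j → half j < u
      half<u j = <-≤-trans (half<S j) S≤u
      D : Fin (2 * S) → ℕ
      D j = unfold (suc (half j)) (parity j)
      e : Fin (2 * S) → Fin N
      e j = neighbour {x} (D j)
      diff-e : ∀ j → diff X (toℕ (e j)) ≡ D j
      diff-e j = diff-neighbour {x} (proj₂ (unfold-bounds (parity j) (half<u j)))
      fold-e : ∀ j → dist (diff X (toℕ (e j))) ≡ suc (half j) × side (diff X (toℕ (e j))) ≡ parity j
      fold-e j rewrite diff-e j = fold-unfold (half<u j) (m%n<n (toℕ j) 2)
      e-injective : Injective _≡_ _≡_ e
      e-injective {j} {j'} e≡ = toℕ-injective (begin
        toℕ j                    ≡⟨ m≡m%n+[m/n]*n (toℕ j) 2 ⟩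
        parity j + half j * 2    ≡⟨ cong₂ (λ b h → b + h * 2) parity≡ half≡ ⟩
        parity j' + half j' * 2  ≡⟨ m≡m%n+[m/n]*n (toℕ j') 2 ⟨
        toℕ j'                   ∎)
        where
        open ≡-Reasoning
        half≡ : half j ≡ half j'
        half≡ = suc-injective
          (trans (sym (proj₁ (fold-e j))) (trans (cong (λ y → dist (diff X (toℕ y))) e≡) (proj₁ (fold-e j'))))
        parity≡ : parity j ≡ parity j'
        parity≡ = trans (sym (proj₂ (fold-e j))) (trans (cong (λ y → side (diff X (toℕ y))) e≡) (proj₂ (fold-e j')))
      e≢x : ∀ j → e j ≢ x
      e≢x j e≡x = <⇒≢ (proj₁ (unfold-bounds (parity j) (half<u j)))
        (sym (trans (sym (diff-e j)) (trans (cong (diff X ∘ toℕ) e≡x) (diff-self (toℕ<n x)))))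
      e-below : ∀ j → label x (e j) < S
      e-below j = subst (_< S) (sym (cong (_∸ 1) (proj₁ (fold-e j)))) (half<S j)

-- The thresholds

NonArrowingGraph : ∀ {t} → ℕ → (Fin t → ℕ) → ℕ → Set
NonArrowingGraph n m d = Σ[ G ∈ Graph n ] MinDegreeAtLeast G d × ¬ Arrows G m

isMinDegreeThreshold : ∀ {n t} {m : Fin t → ℕ} {d} → (∀ G → MinDegreeAtLeast G d → Arrows G m) →
  NonArrowingGraph n m (d ∸ 1) → IsMinDegreeThreshold n m d
isMinDegreeThreshold arrows (G , δ≥d∸1 , ¬arrows) = arrows , λ d' arrows' →
  ≮⇒≥ λ d'<d → ¬arrows (arrows' G λ v → ≤-trans (<⇒≤pred d'<d) (δ≥d∸1 v))

module _ {t : ℕ} {m w : Fin (suc t) → ℕ} (m≡suc-w : ∀ i → m i ≡ suc (w i)) where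

  private
    w<m : ∀ i → w i < m i
    w<m i = ≤-reflexive (sym (m≡suc-w i))

  complete-¬arrows : ∀ N → N ≤ sum w → ¬ Arrows (complete N) m
  complete-¬arrows zero    _     arrows with arrows (record { col = λ () ; col-sym = λ () })
  ... | _ , () , _
  complete-¬arrows (suc N) N≤sum = ¬arrows-of-label (complete (suc N)) w<m label label-sym
    (λ x y _ → <-≤-trans (label<q x y) N≤sum) (λ x _ _ → label-injective x)
    where open SumLabelling (suc N)

  sum<ramsey : ∀ {r} → IsStarRamseyNumber m r → sum w < r
  sum<ramsey (arrows , _) = ≰⇒> λ r≤sum → complete-¬arrows _ r≤sum arrows

  roundRobin-nonArrowing : ∀ h → sum w < 2 * h → NonArrowingGraph (2 * h) m (sum w)
  roundRobin-nonArrowing zero    ()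
  roundRobin-nonArrowing (suc u) sum<n =
    subst (λ n → NonArrowingGraph n m (sum w)) (sym (*-suc 2 u)) (graph (sum w) , δ≥sum , ¬arrows w<m label-injective)
    where
    open RoundRobin u
    open Threshold label label-sym
    sum≤q : sum w ≤ q
    sum≤q = s≤s⁻¹ (subst (sum w <_) (*-suc 2 u) sum<n)
    δ≥sum : MinDegreeAtLeast (graph (sum w)) (sum w)
    δ≥sum x = subst (sum w ≤_) (sym (degree≡count (graph (sum w)) x))
      (degree≥-of-preimages x λ c<sum → preimage x (<-≤-trans c<sum sum≤q))

  sumGraph-nonArrowing : ∀ q → sum w ≤ suc q → NonArrowingGraph (suc q) m (sum w ∸ 1)
  sumGraph-nonArrowing q sum≤q = graph (sum w) ,
    (λ x → subst (sum w ∸ 1 ≤_) (sym (degree≡count (graph (sum w)) x))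
             (degree≥∸1-of-preimages x λ {c} c<sum → preimage x c , tt , label-preimage x (<-≤-trans c<sum sum≤q))) ,
    ¬arrows w<m (λ x _ _ → label-injective x)
    where
    open SumLabelling (suc q)
    open Threshold label label-sym

  circulant-nonArrowing : (∀ i → ¬ 2 ∣ m i) → ∀ u → sum w < suc (2 * u) → NonArrowingGraph (suc (2 * u)) m (sum w)
  circulant-nonArrowing m-odd u sum<N = graph w₂ ,
    (λ x → subst₂ _≤_ (sym sum≡) (sym (degree≡count (graph w₂) x)) (degree≥ w₂ sum₂≤u x)) ,
    ¬arrows w₂ (λ i → subst (_< m i) (w≡2w₂ i) (w<m i))
    where
    open Circulant u
    w₂ : Fin (suc t) → ℕ
    w₂ i = proj₁ (odd⇒≡suc-2* (m-odd i))
    w≡2w₂ : ∀ i → w i ≡ 2 * w₂ i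
    w≡2w₂ i = suc-injective (trans (sym (m≡suc-w i)) (proj₂ (odd⇒≡suc-2* (m-odd i))))
    sum≡ : sum w ≡ 2 * sum w₂
    sum≡ = trans (sum-cong-≗ w≡2w₂) (sum-* 2 w₂)
    sum₂≤u : sum w₂ ≤ u
    sum₂≤u = *-cancelˡ-≤ 2 (s≤s⁻¹ (subst (_< suc (2 * u)) sum≡ sum<N))

  δ>sum-threshold : ∀ {n} → sum w < n → NonArrowingGraph n m (sum w) → IsMinDegreeThreshold n m (sum w + 1)
  δ>sum-threshold sum<n nonArrowing = isMinDegreeThreshold
    (λ G δ> → arrows-of-degree> G m≡suc-w (fromℕ< sum<n)
                (subst₂ _≤_ (+-comm (sum w) 1) (degree≡count G (fromℕ< sum<n)) (δ> (fromℕ< sum<n))))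
    (subst (NonArrowingGraph _ m) (sym (m+n∸n≡m (sum w) 1)) nonArrowing)

  δ≥sum-threshold : ∀ u → sum w < suc (2 * u) → ∀ i₀ → 2 ∣ m i₀ → IsMinDegreeThreshold (suc (2 * u)) m (sum w)
  δ≥sum-threshold u sum<n i₀ m-even = isMinDegreeThreshold
    (λ G δ≥ → arrows-of-odd-degree≥ G m≡suc-w (¬2∣suc-2* u) i₀ w-odd (λ v → subst (sum w ≤_) (degree≡count G v) (δ≥ v)))
    (sumGraph-nonArrowing (2 * u) (<⇒≤ sum<n))
    where
    w-odd : ¬ 2 ∣ w i₀
    w-odd 2∣w = 2≢1 (∣1⇒≡1 (∣m+n∣m⇒∣n (subst (2 ∣_) (trans (m≡suc-w i₀) (+-comm 1 (w i₀))) m-even) 2∣w))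
      where
      2≢1 : 2 ≢ 1
      2≢1 ()

  thresholds : ∀ k → (∀ i → toℕ i < k → 2 ∣ m i) → (∀ i → k ≤ toℕ i → ¬ 2 ∣ m i) → ∀ {n} → sum w < n →
      ((k ≡ 0 ⊎ 2 ∣ n) → IsMinDegreeThreshold n m (sum w + 1))
    × (¬ (k ≡ 0 ⊎ 2 ∣ n) → IsMinDegreeThreshold n m (sum w))
  thresholds k m-even m-odd {n} sum<n with parity-split n
  ... | inj₁ (h , refl) =
    (λ _ → δ>sum-threshold sum<n (roundRobin-nonArrowing h sum<n)) ,
    (λ ¬k≡0⊎even → ⊥-elim (¬k≡0⊎even (inj₂ (divides h (*-comm 2 h)))))
  ... | inj₂ (u , refl) =
    [ (λ { refl → δ>sum-threshold sum<n (circulant-nonArrowing (λ i → m-odd i z≤n) u sum<n) }) , ⊥-elim ∘ ¬2∣suc-2* u ]′ ,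
    (λ ¬k≡0⊎even → δ≥sum-threshold u sum<n zero (m-even zero (n≢0⇒n>0 (¬k≡0⊎even ∘ inj₁))))

≡suc-∸1 : ∀ {n} → 1 ≤ n → n ≡ suc (n ∸ 1)
≡suc-∸1 (s≤s _) = refl

theorem4p1 : (t k : ℕ) → 2 ≤ t → k ≤ t → (m : Fin t → ℕ)
    → (∀ i → 2 ≤ m i)
    → (∀ i → toℕ i < k → 2 ∣ m i)
    → (∀ i → k ≤ toℕ i → ¬ (2 ∣ m i))
    → (r n : ℕ) → IsStarRamseyNumber m r → r ≤ n
    → ((k ≡ 0 ⊎ 2 ∣ n) → IsMinDegreeThreshold n m (sumFin m ∸ t + 1))
      × (¬ (k ≡ 0 ⊎ 2 ∣ n) → IsMinDegreeThreshold n m (sumFin m ∸ t))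
theorem4p1 (suc t) k _ _ m m≥2 m-even m-odd r n ramsey r≤n =
  subst (λ s → ((k ≡ 0 ⊎ 2 ∣ n) → IsMinDegreeThreshold n m (s + 1)) × (¬ (k ≡ 0 ⊎ 2 ∣ n) → IsMinDegreeThreshold n m s))
    (sym (sumFin∸≡sum m≡suc-w))
    (thresholds m≡suc-w k m-even m-odd (<-≤-trans (sum<ramsey m≡suc-w ramsey) r≤n))
  where
  m≡suc-w : ∀ i → m i ≡ suc (m i ∸ 1)
  m≡suc-w i = ≡suc-∸1 (<⇒≤ (m≥2 i))
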